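{- Let $G$ be an instance of well-structured MAP, and let $H$ be a spanning subgraph of $G$ that contains all zero-edges of $G$ and is simple, bridgeless and of minimum degree at least two. Let $\mathcal{A}$ be a small 2ec-block of $H$ that is a 3-cycle. If $\mathcal{A}$ is adjacent in $G$ to at least two other 2ec-blocks of $H$, then $\mathcal{A}$ has a good swappable edge.
   Context: An instance of MAP is a loop-free, 2-edge connected multigraph $G$ with edge costs in $\{0,1\}$ whose cost-$0$ edges ("zero-edges") form a matching; cost-$1$ edges are unit-edges. A graph is 2-edge connected (2EC) if it has at least $2$ nodes and is connected after deleting any single edge. It is 2NC if it has at least $3$ nodes and is connected after deleting any single node. A 2-ECSS is a 2EC spanning subgraph, and $\mathrm{opt}(\cdot)$ is its minimum cost. $G/S$ identifies the nodes of $S$ into a node $\hat v$ and deletes the edges inside $S$. For a cut node $w$ of a 2EC graph $M$, a 2ec-$w$-block is the subgraph induced by $\{w\}\cup V(D)$ for a component $D$ of $M-w$. An attachment of a subgraph $C$ of $G$ is a node of $C$ with a neighbour in $V(G)-V(C)$, and $\delta(S)$ is the set of edges with exactly one end in $S$. An instance of well-structured MAP is an instance of MAP with at least $12$ nodes containing none of the following: a cut node; parallel edges; a zero-cost S2; a unit-cost S2; an S$\{3,4\}$; an R4; an R8. These are defined as follows. (1) A zero-cost S2 is a zero-edge $uv$ with $G-\{u,v\}$ disconnected. (2) A unit-cost S2 is a unit-edge $uv$ with $G-\{u,v\}$ disconnected such that $G/\{u,v\}$ has two distinct 2ec-$\hat v$-blocks, each with $\mathrm{opt}\ge3$ and each containing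 a zero-edge incident to $\hat v$. (3) An S$\{3,4\}$ is an induced 2NC subgraph $C$ with $|V(C)|\in\{3,4\}$ satisfying all of the following. It has a spanning cycle of cost $2$. The graph $G-V(C)$ is disconnected. The cut $\delta(V(C))$ has no zero-edge. The graph $G/V(C)$ has two distinct 2ec-$\hat v$-blocks, each with $\mathrm{opt}\ge3$. (4) An R4 is an induced subgraph $C$ on $4$ nodes, $V(C)\ne V(G)$, containing a 4-cycle of cost $2$ and two nonadjacent nodes each of degree $2$ in $G$. (5) An R8 is an induced subgraph $C$ on $8$ nodes, $V(C)\ne V(G)$, satisfying all of the following. It contains two node-disjoint 4-cycles $C_1,C_2$ of cost $2$. It has exactly two attachments $a_1\in V(C_1)$ and $a_2\in V(C_2)$. For $i=1,2$, both ends of the unique unit-edge of $C_i-a_i$ are adjacent to $V(C_{3-i})$. A 2ec-block of $H$ is a maximal connected subgraph of $H$ with at least two nodes and no bridges; here these are the connected components of $H$. A 2ec-block is small if it has at most $2$ unit-edges. For a small 2ec-block $\mathcal{A}$ of $H$: - A unit-edge $uw$ of $\mathcal{A}$ is swappable if both $u$ and $w$ are attachments of $\mathcal{A}$ in $G$. - A swappable edge $uw$ is good if there are distinct 2ec-blocks $B_u,B_w$ of $H$, both different from $\mathcal{A}$, such that $G$ has an edge from $u$ to a node of $B_u$ and an edge from $w$ to a node of $B_w$; otherwise it is bad. -}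

module Defs where

open import Data.Nat using (ℕ; zero; suc; _+_; _≤_)
open import Data.Fin using (Fin; _≟_)
open import Data.Bool using (Bool; true; false; _∧_; _∨_; not; if_then_else_)
open import Data.Product using (Σ; ∃; ∃-syntax; _×_; _,_; proj₁; proj₂)
open import Data.Sum using (_⊎_)
open import Data.Unit using (⊤)
open import Relation.Nullary using (¬_)
open import Relation.Nullary.Decidable using (⌊_⌋)
open import Relation.Binary.PropositionalEquality using (_≡_; _≢_)

-- Nodes are Fin n, edges are Fin m, every edge has
-- an (ordered) pair of ends; the cost of an edge is 1 if 'unit e ≡ true'
-- and 0 otherwise (so costs are in {0,1} by construction).

record Gr : Set where
  field
    n    : ℕ
    m    : ℕ
    ends : Fin m → Fin n × Fin n
    unit : Fin m → Bool
open Gr public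

Sub : ℕ → Set
Sub k = Fin k → Bool

full : ∀ {k} → Sub k
full _ = true

count : ∀ {k} → Sub k → ℕ
count {zero}  S = 0
count {suc k} S = (if S Fin.zero then 1 else 0) + count (λ i → S (Fin.suc i))

_─_ : ∀ {k} → Sub k → Fin k → Sub k
(S ─ v) x = S x ∧ not ⌊ x ≟ v ⌋

_∖_ : ∀ {k} → Sub k → Sub k → Sub k
(S ∖ T) x = S x ∧ not (T x)

_＋_ : ∀ {k} → Sub k → Fin k → Sub k
(S ＋ v) x = S x ∨ ⌊ x ≟ v ⌋

Distinct : ∀ {k} → Sub k → Sub k → Set
Distinct S T = ∃[ x ] S x ≢ T x

_⊆_ : ∀ {k} → Sub k → Sub k → Set
S ⊆ T = ∀ x → S x ≡ true → T x ≡ true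

module _ (g : Gr) where

  Link : Fin (m g) → Fin (n g) → Fin (n g) → Set
  Link e x y = ends g e ≡ (x , y) ⊎ ends g e ≡ (y , x)

  inc : Fin (n g) → Fin (m g) → Bool
  inc v e = ⌊ proj₁ (ends g e) ≟ v ⌋ ∨ ⌊ proj₂ (ends g e) ≟ v ⌋

  -- A (sub)graph "view" of g is given by a node set N and an edge set F;
  -- its edges are the edges of F with both ends in N.

  act : Sub (n g) → Sub (m g) → Sub (m g)
  act N F e = F e ∧ N (proj₁ (ends g e)) ∧ N (proj₂ (ends g e))

  data Reach (N : Sub (n g)) (F : Sub (m g)) : Fin (n g) → Fin (n g) → Set where
    here : ∀ {x} → Reach N F x x
    step : ∀ {x y z} (e : Fin (m g)) → act N F e ≡ true → Link e x y →
           Reach N F y z → Reach N F x z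

  Connected : Sub (n g) → Sub (m g) → Set
  Connected N F = ∀ x y → N x ≡ true → N y ≡ true → Reach N F x y

  deg : Sub (n g) → Sub (m g) → Fin (n g) → ℕ
  deg N F v = count (λ e → act N F e ∧ inc v e)

  cost : Sub (n g) → Sub (m g) → ℕ
  cost N F = count (λ e → act N F e ∧ unit g e)

  TwoEC : Sub (n g) → Sub (m g) → Set
  TwoEC N F = 2 ≤ count N × Connected N F ×
              (∀ e → act N F e ≡ true → Connected N (F ─ e))

  TwoNC : Sub (n g) → Sub (m g) → Set
  TwoNC N F = 3 ≤ count N × Connected N F ×
              (∀ v → N v ≡ true → Connected (N ─ v) F)

  OptGe3 : Sub (n g) → Sub (m g) → Set
  OptGe3 N F = ∀ (F' : Sub (m g)) → F' ⊆ act N F → TwoEC N F' → 3 ≤ cost N F'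

  IsComponent : Sub (n g) → Sub (m g) → Sub (n g) → Set
  IsComponent N F D = (∃[ x ] D x ≡ true) ×
    (∀ x y → D x ≡ true → (D y ≡ true → N y ≡ true × Reach N F x y)
                        × (N y ≡ true → Reach N F x y → D y ≡ true))

  IsCycle : Sub (n g) → Sub (m g) → Set
  IsCycle N F = Connected N F × (∀ v → N v ≡ true → deg N F v ≡ 2)

  HasSpanCycle : Sub (n g) → Sub (m g) → ℕ → Set
  HasSpanCycle N F c = ∃[ F' ] F' ⊆ act N F × IsCycle N F' × cost N F' ≡ c

  Adj : Fin (n g) → Fin (n g) → Set
  Adj x y = ∃[ e ] Link e x y

  Attach : Sub (n g) → Fin (n g) → Set
  Attach C x = C x ≡ true × ∃[ y ] C y ≡ false × Adj x y

  Parallel : Sub (m g) → Set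
  Parallel F = ∃[ e ] ∃[ e' ] e ≢ e' × F e ≡ true × F e' ≡ true ×
               Link e' (proj₁ (ends g e)) (proj₂ (ends g e))

-- Contraction G/S : the nodes of S are identified into the node s ∈ S
-- (playing the role of v̂), and the edges inside S are deleted.
-- The result is again a view on the same index sets.

contractGr : (g : Gr) → Sub (n g) → Fin (n g) → Gr
contractGr g S s = record
  { n = n g ; m = m g ; unit = unit g
  ; ends = λ e → f (proj₁ (ends g e)) , f (proj₂ (ends g e)) }
  where f : Fin (n g) → Fin (n g)
        f x = if S x then s else x

contractN : (g : Gr) → Sub (n g) → Fin (n g) → Sub (n g)
contractN g S s x = not (S x) ∨ ⌊ x ≟ s ⌋

contractF : (g : Gr) → Sub (n g) → Sub (m g)
contractF g S e = not (S (proj₁ (ends g e)) ∧ S (proj₂ (ends g e)))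

-- For M = G/S (with v̂ = s) and D a component of M - v̂, the 2ec-v̂-block
-- is the subgraph of M induced by D ∪ {v̂}.
HeavyBlock : (g : Gr) → Sub (n g) → Fin (n g) → Bool → Sub (n g) → Set
HeavyBlock g S s withZero D =
  IsComponent g' (N' ─ s) F' D × OptGe3 g' (D ＋ s) F' × ZeroCond withZero
  where
  g' = contractGr g S s
  N' = contractN g S s
  F' = contractF g S
  ZeroCond : Bool → Set
  ZeroCond false = ⊤
  ZeroCond true  = ∃[ e ] act g' (D ＋ s) F' e ≡ true × unit g e ≡ false ×
                   inc g' s e ≡ true

-- The representative s of S
-- is arbitrary (all choices give isomorphic contractions).
TwoHeavyBlocks : (g : Gr) → Sub (n g) → Bool → Set
TwoHeavyBlocks g S withZero =
  ∃[ s ] S s ≡ true × ∃[ D₁ ] ∃[ D₂ ]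
    HeavyBlock g S s withZero D₁ × HeavyBlock g S s withZero D₂ × Distinct D₁ D₂

pair : ∀ {k} → Fin k → Fin k → Sub k
pair u v x = ⌊ x ≟ u ⌋ ∨ ⌊ x ≟ v ⌋

module _ (g : Gr) where

  LoopFree : Set
  LoopFree = ∀ e → proj₁ (ends g e) ≢ proj₂ (ends g e)

  ZeroMatching : Set
  ZeroMatching = ∀ e e' → e ≢ e' → unit g e ≡ false → unit g e' ≡ false →
                 ∀ v → inc g v e ≡ true → inc g v e' ≡ false

  IsMAP : Set
  IsMAP = LoopFree × TwoEC g full full × ZeroMatching

  CutNode : Fin (n g) → Set
  CutNode w = ¬ Connected g (full ─ w) full

  PairSep : Fin (m g) → Set
  PairSep e = ¬ Connected g (full ∖ pair (proj₁ (ends g e)) (proj₂ (ends g e))) full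

  ZeroS2 : Fin (m g) → Set
  ZeroS2 e = unit g e ≡ false × PairSep e

  UnitS2 : Fin (m g) → Set
  UnitS2 e = unit g e ≡ true × PairSep e ×
             TwoHeavyBlocks g (pair (proj₁ (ends g e)) (proj₂ (ends g e))) true

  -- C is an S{3,4} (C is identified with the subgraph of G induced by C)
  S34 : Sub (n g) → Set
  S34 C = (count C ≡ 3 ⊎ count C ≡ 4) × TwoNC g C full ×
          HasSpanCycle g C full 2 ×
          ¬ Connected g (full ∖ C) full ×
          (∀ e → unit g e ≡ false →
             C (proj₁ (ends g e)) ≡ C (proj₂ (ends g e))) ×
          TwoHeavyBlocks g C false

  R4 : Sub (n g) → Set
  R4 C = count C ≡ 4 × (∃[ x ] C x ≡ false) ×
         HasSpanCycle g C full 2 ×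
         (∃[ x ] ∃[ y ] C x ≡ true × C y ≡ true × x ≢ y × ¬ Adj g x y ×
            deg g full full x ≡ 2 × deg g full full y ≡ 2)

  R8 : Sub (n g) → Set
  R8 C = count C ≡ 8 × (∃[ x ] C x ≡ false) ×
    ∃[ C₁ ] ∃[ C₂ ] ∃[ a₁ ] ∃[ a₂ ] Σ (Sub (m g)) λ F₁ → Σ (Sub (m g)) λ F₂ →
      C₁ ⊆ C × C₂ ⊆ C × (∀ x → C₁ x ≡ true → C₂ x ≡ false) ×
      count C₁ ≡ 4 × count C₂ ≡ 4 ×
      F₁ ⊆ act g C₁ full × IsCycle g C₁ F₁ × cost g C₁ F₁ ≡ 2 ×
      F₂ ⊆ act g C₂ full × IsCycle g C₂ F₂ × cost g C₂ F₂ ≡ 2 ×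
      C₁ a₁ ≡ true × C₂ a₂ ≡ true ×
      (∀ x → Attach g C x → x ≡ a₁ ⊎ x ≡ a₂) ×
      Attach g C a₁ × Attach g C a₂ ×
      (∀ e → F₁ e ≡ true → unit g e ≡ true → inc g a₁ e ≡ false →
         ∀ u → inc g u e ≡ true → ∃[ y ] C₂ y ≡ true × Adj g u y) ×
      (∀ e → F₂ e ≡ true → unit g e ≡ true → inc g a₂ e ≡ false →
         ∀ u → inc g u e ≡ true → ∃[ y ] C₁ y ≡ true × Adj g u y)

  WellStructured : Set
  WellStructured = IsMAP × 12 ≤ n g ×
    (∀ w → ¬ CutNode w) × ¬ Parallel g full ×
    (∀ e → ¬ ZeroS2 e) × (∀ e → ¬ UnitS2 e) ×
    (∀ C → ¬ S34 C) × (∀ C → ¬ R4 C) × (∀ C → ¬ R8 C)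

  GoodH : Sub (m g) → Set
  GoodH H = (∀ e → unit g e ≡ false → H e ≡ true) ×
            ¬ Parallel g H ×
            (∀ e → H e ≡ true →
               Reach g full (H ─ e) (proj₁ (ends g e)) (proj₂ (ends g e))) ×
            (∀ v → 2 ≤ deg g full H v)

  -- 2ec-blocks of H (= its connected components here); a block is given
  -- by its node set, with all H-edges inside it
  Block : Sub (m g) → Sub (n g) → Set
  Block H B = IsComponent g full H B

  Small : Sub (m g) → Sub (n g) → Set
  Small H A = count (λ e → act g A H e ∧ unit g e) ≤ 2

  IsTriangle : Sub (m g) → Sub (n g) → Set
  IsTriangle H A = count A ≡ 3 × IsCycle g A H

  AdjSet : Sub (n g) → Sub (n g) → Set
  AdjSet A B = ∃[ x ] ∃[ y ] A x ≡ true × B y ≡ true × Adj g x y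

  AdjTo : Fin (n g) → Sub (n g) → Set
  AdjTo x B = ∃[ y ] B y ≡ true × Adj g x y

  Swappable : Sub (m g) → Sub (n g) → Fin (m g) → Set
  Swappable H A e = act g A H e ≡ true × unit g e ≡ true ×
    Attach g A (proj₁ (ends g e)) × Attach g A (proj₂ (ends g e))

  Good : Sub (m g) → Sub (n g) → Fin (m g) → Set
  Good H A e = Swappable H A e × ∃[ Bu ] ∃[ Bw ]
    Block H Bu × Block H Bw × Distinct Bu Bw × Distinct Bu A × Distinct Bw A ×
    AdjTo (proj₁ (ends g e)) Bu × AdjTo (proj₂ (ends g e)) Bw

module Submission where

-- Since 𝒜 has at most two unit-edges and zero-edges form a matching, the
-- triangle is x y z with a zero-edge xy and unit-edges zx, zy; these two are
-- the candidate swappable edges.  Two separation facts follow from the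
-- well-structuredness of G: z has a neighbour outside 𝒜 (otherwise G - {x,y}
-- is disconnected and xy is a zero-cost S2), and x or y has one (otherwise z
-- is a cut node).  Every node of G lies in some block of H, so z touches a
-- block C_z and some w ∈ {x,y} touches a block C_w.  A purely combinatorial
-- argument about distinct blocks (a block differs from at least one of any
-- two distinct blocks) then produces, from the two given blocks B₁ ≠ B₂,
-- blocks touched by z and by some w ∈ {x,y} that are different; the edge zw
-- is then good.

open import Defs
open import Data.Product using (∃-syntax; _×_)
open import Data.Bool using (true; false; _∧_; _∨_; not)
open import Data.Bool.Properties
  using (∨-comm; ∧-zeroʳ; ∧-identityʳ; not-injective; ¬-not) renaming (_≟_ to _≟ᵇ_)
open import Data.Empty using (⊥-elim)
open import Data.Fin using (Fin; _≟_)
open import Data.Fin.Properties using (any?)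
open import Data.Nat using (ℕ; zero; suc; _+_; _≤_; z≤n; s≤s)
open import Data.Nat.Properties using (suc-injective; ≤-trans; m≤n⇒m≤1+n; <-irrefl)
open import Data.Product using (Σ; _,_; proj₁; proj₂)
open import Data.Product.Properties using (≡-dec)
open import Data.Sum using (_⊎_; inj₁; inj₂)
open import Relation.Binary.PropositionalEquality using (_≡_; _≢_; refl; sym; trans; cong; subst)
open import Relation.Nullary using (¬_; Dec; yes; no)
open import Relation.Nullary.Decidable using (⌊_⌋; isYes≗does; dec-true; dec-false; _×-dec_; _⊎-dec_)

t≢f : true ≢ false
t≢f ()

∧-elimˡ : ∀ {a b} → a ∧ b ≡ true → a ≡ true
∧-elimˡ {true} _ = refl

∧-elimʳ : ∀ {a b} → a ∧ b ≡ true → b ≡ true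
∧-elimʳ {true} h = h

∨-introˡ : ∀ {a} b → a ≡ true → a ∨ b ≡ true
∨-introˡ b refl = refl

∨-introʳ : ∀ a {b} → b ≡ true → a ∨ b ≡ true
∨-introʳ true  _ = refl
∨-introʳ false h = h

∨-elim : ∀ {a b} → a ∨ b ≡ true → a ≡ true ⊎ b ≡ true
∨-elim {true}  _ = inj₁ refl
∨-elim {false} h = inj₂ h

bool-ext : ∀ {a b} → (a ≡ true → b ≡ true) → (b ≡ true → a ≡ true) → a ≡ b
bool-ext {true}  {true}  _ _ = refl
bool-ext {false} {false} _ _ = refl
bool-ext {true}  {false} f _ = sym (f refl)
bool-ext {false} {true}  _ g = g refl

⌊⌋-true : ∀ {P : Set} (d : Dec P) → P → ⌊ d ⌋ ≡ true
⌊⌋-true d p = trans (isYes≗does d) (dec-true d p)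

⌊⌋-false : ∀ {P : Set} (d : Dec P) → ¬ P → ⌊ d ⌋ ≡ false
⌊⌋-false d ¬p = trans (isYes≗does d) (dec-false d ¬p)

⌊⌋-elim : ∀ {P : Set} (d : Dec P) → ⌊ d ⌋ ≡ true → P
⌊⌋-elim (yes p) _ = p
⌊⌋-elim (no _) ()

del-intro : ∀ {k} (S : Sub k) x {v} → S v ≡ true → v ≢ x → (S ─ x) v ≡ true
del-intro S x h v≢x rewrite h | ⌊⌋-false (_ ≟ x) v≢x = refl

del-elim : ∀ {k} (S : Sub k) x {v} → (S ─ x) v ≡ true → S v ≡ true × v ≢ x
del-elim S x {v} h = ∧-elimˡ h , λ { refl → t≢f (trans (sym h) (removed (S x))) }
  where
  removed : ∀ b → b ∧ not ⌊ x ≟ x ⌋ ≡ false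
  removed b rewrite ⌊⌋-true (x ≟ x) refl = ∧-zeroʳ b

pair-elim : ∀ {k} {a b v : Fin k} → pair a b v ≡ true → v ≡ a ⊎ v ≡ b
pair-elim {a = a} {b} {v} h with ∨-elim {⌊ v ≟ a ⌋} h
... | inj₁ p = inj₁ (⌊⌋-elim (v ≟ a) p)
... | inj₂ p = inj₂ (⌊⌋-elim (v ≟ b) p)

pair-introˡ : ∀ {k} (a b : Fin k) → pair a b a ≡ true
pair-introˡ a b = ∨-introˡ _ (⌊⌋-true (a ≟ a) refl)

pair-introʳ : ∀ {k} (a b : Fin k) → pair a b b ≡ true
pair-introʳ a b = ∨-introʳ ⌊ b ≟ a ⌋ (⌊⌋-true (b ≟ b) refl)

pair-out : ∀ {k} {a b v : Fin k} → v ≢ a → v ≢ b → pair a b v ≡ false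
pair-out v≢a v≢b rewrite ⌊⌋-false (_ ≟ _) v≢a | ⌊⌋-false (_ ≟ _) v≢b = refl

distinct-at : ∀ {k} {S T : Sub k} v → S v ≡ true → T v ≡ false → Distinct S T
distinct-at v p q = v , λ eq → t≢f (trans (sym p) (trans eq q))

distinct-sym : ∀ {k} {S T : Sub k} → Distinct S T → Distinct T S
distinct-sym (w , ne) = w , λ eq → ne (sym eq)

count-ext : ∀ {k} (S T : Sub k) → (∀ x → S x ≡ T x) → count S ≡ count T
count-ext {zero}  S T h = refl
count-ext {suc k} S T h rewrite h Fin.zero =
  cong (_ +_) (count-ext _ _ (λ i → h (Fin.suc i)))

count-≤ : ∀ {k} (S : Sub k) → count S ≤ k
count-≤ {zero}  S = z≤n
count-≤ {suc k} S with S Fin.zero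
... | true  = s≤s (count-≤ _)
... | false = m≤n⇒m≤1+n (count-≤ _)

count-mono : ∀ {k} (S T : Sub k) → S ⊆ T → count S ≤ count T
count-mono {zero}  S T h = z≤n
count-mono {suc k} S T h with S Fin.zero in eq
... | true rewrite h Fin.zero eq = s≤s (count-mono _ _ (λ i → h (Fin.suc i)))
... | false with T Fin.zero
...   | true  = m≤n⇒m≤1+n (count-mono _ _ (λ i → h (Fin.suc i)))
...   | false = count-mono _ _ (λ i → h (Fin.suc i))

count-del : ∀ {k} (S : Sub k) (x : Fin k) → S x ≡ true → count S ≡ suc (count (S ─ x))
count-del {suc k} S Fin.zero sx rewrite sx =
  cong suc (count-ext _ _ (λ i → sym (∧-identityʳ (S (Fin.suc i)))))
count-del {suc k} S (Fin.suc x) sx with S Fin.zero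
... | true  = cong suc (trans (count-del _ x sx) (cong suc (count-ext _ _ shift)))
  where shift : ∀ i → ((λ j → S (Fin.suc j)) ─ x) i ≡ (S ─ Fin.suc x) (Fin.suc i)
        shift i with i ≟ x
        ... | yes _ = refl
        ... | no _  = refl
... | false = trans (count-del _ x sx) (cong suc (count-ext _ _ shift))
  where shift : ∀ i → ((λ j → S (Fin.suc j)) ─ x) i ≡ (S ─ Fin.suc x) (Fin.suc i)
        shift i with i ≟ x
        ... | yes _ = refl
        ... | no _  = refl

count-member : ∀ {k j} (S : Sub k) → count S ≡ suc j → ∃[ x ] S x ≡ true
count-member {suc k} S h with S Fin.zero in eq
... | true  = Fin.zero , eq
... | false with count-member (λ i → S (Fin.suc i)) h
...   | x , p = Fin.suc x , p

pick : ∀ {k j} (S : Sub k) → count S ≡ suc j → ∃[ x ] S x ≡ true × count (S ─ x) ≡ j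
pick S h with count-member S h
... | x , sx = x , sx , suc-injective (trans (sym (count-del S x sx)) h)

count-zero : ∀ {k} (S : Sub k) x → count S ≡ 0 → S x ≡ false
count-zero S x h with S x in eq
... | false = refl
... | true with () ← trans (sym (count-del S x eq)) h

count-strict : ∀ {k} (S T : Sub k) y → S ⊆ T → S y ≡ false → T y ≡ true →
               suc (count S) ≤ count T
count-strict S T y S⊆T Sy Ty rewrite count-del T y Ty =
  s≤s (count-mono S (T ─ y) (λ x Sx → del-intro T y (S⊆T x Sx) (λ { refl → t≢f (trans (sym Sx) Sy) })))

three-≤ : ∀ {k} (S : Sub k) a b c → S a ≡ true → S b ≡ true → S c ≡ true →
          a ≢ b → a ≢ c → b ≢ c → 3 ≤ count S
three-≤ S a b c Sa Sb Sc a≢b a≢c b≢c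
  rewrite count-del S a Sa
        | count-del (S ─ a) b (del-intro S a Sb (λ p → a≢b (sym p)))
        | count-del ((S ─ a) ─ b) c (del-intro (S ─ a) b (del-intro S a Sc (λ p → a≢c (sym p))) (λ p → b≢c (sym p)))
  = s≤s (s≤s (s≤s z≤n))

count-three : ∀ {k} (S : Sub k) → count S ≡ 3 →
  Σ (Fin k) λ p → Σ (Fin k) λ q → Σ (Fin k) λ r →
  S p ≡ true × S q ≡ true × S r ≡ true × p ≢ q × p ≢ r × q ≢ r ×
  (∀ v → S v ≡ true → v ≡ p ⊎ v ≡ q ⊎ v ≡ r)
count-three S h with pick S h
... | p , Sp , hp with pick (S ─ p) hp
...   | q , Sq' , hq with pick ((S ─ p) ─ q) hq
...     | r , Sr'' , hr =
  p , q , r , Sp , Sq , Sr , (λ e → q≢p (sym e)) , (λ e → r≢p (sym e)) , (λ e → r≢q (sym e)) , cover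
  where
  Sq = proj₁ (del-elim S p Sq')
  q≢p = proj₂ (del-elim S p Sq')
  Sr' = proj₁ (del-elim (S ─ p) q Sr'')
  r≢q = proj₂ (del-elim (S ─ p) q Sr'')
  Sr = proj₁ (del-elim S p Sr')
  r≢p = proj₂ (del-elim S p Sr')
  cover : ∀ v → S v ≡ true → v ≡ p ⊎ v ≡ q ⊎ v ≡ r
  cover v Sv with v ≟ p | v ≟ q | v ≟ r
  ... | yes e | _     | _     = inj₁ e
  ... | no _  | yes e | _     = inj₂ (inj₁ e)
  ... | no _  | no _  | yes e = inj₂ (inj₂ e)
  ... | no a  | no b  | no c  =
    ⊥-elim (t≢f (trans (sym (del-intro ((S ─ p) ─ q) r (del-intro (S ─ p) q (del-intro S p Sv a) b) c))
                       (count-zero _ v hr)))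

module Walks (g : Gr) where

  V : Set
  V = Fin (n g)

  E : Set
  E = Fin (m g)

  link-sym : ∀ {e x y} → Link g e x y → Link g e y x
  link-sym (inj₁ p) = inj₂ p
  link-sym (inj₂ p) = inj₁ p

  link-inc : ∀ {e x y} → Link g e x y → inc g x e ≡ true
  link-inc {x = x} {y} (inj₁ p) rewrite p = ∨-introˡ ⌊ y ≟ x ⌋ (⌊⌋-true (x ≟ x) refl)
  link-inc {x = x} {y} (inj₂ p) rewrite p = ∨-introʳ ⌊ y ≟ x ⌋ (⌊⌋-true (x ≟ x) refl)

  inc-link : ∀ {v e} → inc g v e ≡ true → ∃[ o ] Link g e v o
  inc-link {v} {e} h with ∨-elim h
  ... | inj₁ h₁ = proj₂ (ends g e) , inj₁ (cong (_, _) (⌊⌋-elim (_ ≟ v) h₁))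
  ... | inj₂ h₂ = proj₁ (ends g e) , inj₂ (cong (_ ,_) (⌊⌋-elim (_ ≟ v) h₂))

  link-unique : ∀ {e a b c d} → Link g e a b → Link g e c d →
                (a ≡ c × b ≡ d) ⊎ (a ≡ d × b ≡ c)
  link-unique (inj₁ p) (inj₁ q) with refl ← trans (sym p) q = inj₁ (refl , refl)
  link-unique (inj₁ p) (inj₂ q) with refl ← trans (sym p) q = inj₂ (refl , refl)
  link-unique (inj₂ p) (inj₁ q) with refl ← trans (sym p) q = inj₂ (refl , refl)
  link-unique (inj₂ p) (inj₂ q) with refl ← trans (sym p) q = inj₁ (refl , refl)

  link-same-ends : ∀ {e e' a b} → Link g e a b → Link g e' a b →
                   Link g e' (proj₁ (ends g e)) (proj₂ (ends g e))
  link-same-ends (inj₁ p) l' rewrite p = l'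
  link-same-ends (inj₂ p) l' rewrite p = link-sym l'

  ends-pair : ∀ {e a b} → Link g e a b → ∀ v →
              pair (proj₁ (ends g e)) (proj₂ (ends g e)) v ≡ pair a b v
  ends-pair (inj₁ p) v rewrite p = refl
  ends-pair {a = a} {b} (inj₂ p) v rewrite p = ∨-comm ⌊ v ≟ b ⌋ ⌊ v ≟ a ⌋

  link? : ∀ e x y → Dec (Link g e x y)
  link? e x y = ≡-dec _≟_ _≟_ (ends g e) (x , y) ⊎-dec ≡-dec _≟_ _≟_ (ends g e) (y , x)

  adj? : ∀ x y → Dec (Adj g x y)
  adj? x y = any? (λ e → link? e x y)

  attach? : (A : Sub (n g)) → ∀ v → Dec (Attach g A v)
  attach? A v = (A v ≟ᵇ true) ×-dec any? (λ q → (A q ≟ᵇ false) ×-dec adj? v q)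

  act-ends : ∀ {N F e a b} → act g N F e ≡ true → Link g e a b → N a ≡ true × N b ≡ true
  act-ends {F = F} {e} h (inj₁ p) rewrite p = ∧-elimˡ (∧-elimʳ {F e} h) , ∧-elimʳ (∧-elimʳ {F e} h)
  act-ends {F = F} {e} h (inj₂ p) rewrite p = ∧-elimʳ (∧-elimʳ {F e} h) , ∧-elimˡ (∧-elimʳ {F e} h)

  reach-snoc : ∀ {N F x y z} → Reach g N F x y → (e : E) → act g N F e ≡ true →
               Link g e y z → Reach g N F x z
  reach-snoc here              e a l = step e a l here
  reach-snoc (step e' a' l' r) e a l = step e' a' l' (reach-snoc r e a l)

  reach-sym : ∀ {N F x y} → Reach g N F x y → Reach g N F y x
  reach-sym here           = here
  reach-sym (step e a l r) = reach-snoc (reach-sym r) e a (link-sym l)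

  reach-trans : ∀ {N F x y z} → Reach g N F x y → Reach g N F y z → Reach g N F x z
  reach-trans here           r' = r'
  reach-trans (step e a l r) r' = step e a l (reach-trans r r')

  reach-invariant : ∀ {N F} (P : V → Set) →
                    (∀ e x y → act g N F e ≡ true → Link g e x y → P x → P y) →
                    ∀ {x y} → Reach g N F x y → P x → P y
  reach-invariant P h here           px = px
  reach-invariant P h (step e a l r) px = reach-invariant P h r (h e _ _ a l px)

  component-include : ∀ {N F D D'} c → IsComponent g N F D → IsComponent g N F D' →
                      D c ≡ true → D' c ≡ true → ∀ y → D y ≡ true → D' y ≡ true
  component-include c (_ , C) (_ , C') d d' y dy =
    proj₂ (C' c y d') (proj₁ (proj₁ (C c y d) dy)) (proj₂ (proj₁ (C c y d) dy))

  component-same : ∀ {N F D₁ D₂} c → IsComponent g N F D₁ → IsComponent g N F D₂ →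
                   D₁ c ≡ true → D₂ c ≡ true → ∀ y → D₁ y ≡ D₂ y
  component-same c C₁ C₂ c₁ c₂ y =
    bool-ext (component-include c C₁ C₂ c₁ c₂ y) (component-include c C₂ C₁ c₂ c₁ y)

  component-disjoint : ∀ {N F D₁ D₂} → IsComponent g N F D₁ → IsComponent g N F D₂ →
                       Distinct D₁ D₂ → ∀ x → D₁ x ≡ true → D₂ x ≡ false
  component-disjoint {D₂ = D₂} C₁ C₂ (w , ne) x d₁ with D₂ x in d₂
  ... | false = refl
  ... | true  = ⊥-elim (ne (component-same x C₁ C₂ d₁ d₂ w))

  distinct-from-one : ∀ {N F C B₁ B₂} → IsComponent g N F C →
                      IsComponent g N F B₁ → IsComponent g N F B₂ → Distinct B₁ B₂ →
                      Distinct C B₁ ⊎ Distinct C B₂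
  distinct-from-one {B₁ = B₁} C@((c , Cc) , _) C₁ C₂ (w , ne) with B₁ c in B₁c
  ... | false = inj₁ (distinct-at c Cc B₁c)
  ... | true  = inj₂ (w , λ eq → ne (trans (sym (component-same c C C₁ Cc B₁c w)) eq))

  -- Breadth-first search from t along the edges of F; layer k is the set of
  -- nodes reachable from t by a walk of length at most k.  After n g steps
  -- the layers are closed, which yields the component of t.
  module Search (F : Sub (m g)) (t : V) where

    Enters : Sub (n g) → V → E → Set
    Enters S y e = act g full F e ≡ true × ∃[ a ] S a ≡ true × Link g e a y

    enters? : ∀ S y e → Dec (Enters S y e)
    enters? S y e = (act g full F e ≟ᵇ true) ×-dec
                    any? (λ a → (S a ≟ᵇ true) ×-dec link? e a y)

    grow : Sub (n g) → Sub (n g)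
    grow S y = S y ∨ ⌊ any? (enters? S y) ⌋

    grow-keep : ∀ S → S ⊆ grow S
    grow-keep S y h = ∨-introˡ _ h

    grow-enter : ∀ S {a y} e → act g full F e ≡ true → S a ≡ true → Link g e a y →
                 grow S y ≡ true
    grow-enter S {a} {y} e ac Sa l =
      ∨-introʳ (S y) (⌊⌋-true (any? (enters? S y)) (e , ac , a , Sa , l))

    grow-elim : ∀ S y → grow S y ≡ true → S y ≡ true ⊎ ∃[ e ] Enters S y e
    grow-elim S y h with ∨-elim {S y} h
    ... | inj₁ p = inj₁ p
    ... | inj₂ p = inj₂ (⌊⌋-elim (any? (enters? S y)) p)

    grow-mono : ∀ S T → S ⊆ T → grow S ⊆ grow T
    grow-mono S T S⊆T y h with grow-elim S y h
    ... | inj₁ p                     = grow-keep T y (S⊆T y p)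
    ... | inj₂ (e , ac , a , Sa , l) = grow-enter T e ac (S⊆T a Sa) l

    layer : ℕ → Sub (n g)
    layer zero    y = ⌊ y ≟ t ⌋
    layer (suc k)   = grow (layer k)

    layer-start : ∀ k → layer k t ≡ true
    layer-start zero    = ⌊⌋-true (t ≟ t) refl
    layer-start (suc k) = grow-keep (layer k) t (layer-start k)

    layer-reach : ∀ k y → layer k y ≡ true → Reach g full F t y
    layer-reach zero    y h with refl ← ⌊⌋-elim (y ≟ t) h = here
    layer-reach (suc k) y h with grow-elim (layer k) y h
    ... | inj₁ p                     = layer-reach k y p
    ... | inj₂ (e , ac , a , Sa , l) = reach-snoc (layer-reach k a Sa) e ac l

    Closed : Sub (n g) → Set
    Closed S = grow S ⊆ S

    closed-or-large : ∀ k → Closed (layer k) ⊎ suc k ≤ count (layer k)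
    closed-or-large zero rewrite count-del (layer zero) t (layer-start zero) = inj₂ (s≤s z≤n)
    closed-or-large (suc k)
      with any? (λ y → (layer (suc k) y ≟ᵇ true) ×-dec (layer k y ≟ᵇ false))
    ... | no none = inj₁ (grow-mono (layer (suc k)) (layer k) stuck)
      where
      stuck : layer (suc k) ⊆ layer k
      stuck y h with layer k y ≟ᵇ false
      ... | yes old = ⊥-elim (none (y , h , old))
      ... | no ¬old = ¬-not ¬old
    ... | yes (y , new , old) with closed-or-large k
    ...   | inj₁ closed = ⊥-elim (t≢f (trans (sym (closed y new)) old))
    ...   | inj₂ large  =
      inj₂ (≤-trans (s≤s large) (count-strict (layer k) (layer (suc k)) y (grow-keep (layer k)) old new))

    component : Sub (n g)
    component = layer (n g)

    component-closed : Closed component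
    component-closed with closed-or-large (n g)
    ... | inj₁ closed = closed
    ... | inj₂ large  = ⊥-elim (<-irrefl refl (≤-trans large (count-≤ component)))

    component-is : IsComponent g full F component
    component-is = (t , layer-start (n g)) , λ x y Cx →
      (λ Cy → refl , reach-trans (reach-sym (layer-reach (n g) x Cx)) (layer-reach (n g) y Cy)) ,
      (λ _ r → reach-invariant (λ v → component v ≡ true)
                 (λ e _ v ac l Cu → component-closed v (grow-enter component e ac Cu l)) r Cx)

  component-of : (F : Sub (m g)) (t : V) → ∃[ D ] IsComponent g full F D × D t ≡ true
  component-of F t = Search.component F t , Search.component-is F t , Search.layer-start F t (n g)

  -- A node set X whose neighbours all lie in X or in S cannot be left by a
  -- walk avoiding S; so G - S is disconnected as soon as it meets both X and
  -- the complement of X.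
  trapped : (S X : Sub (n g)) →
            (∀ v w → X v ≡ true → Adj g v w → X w ≡ true ⊎ S w ≡ true) →
            ∀ v o → X v ≡ true → X o ≡ false → S v ≡ false → S o ≡ false →
            ¬ Connected g (full ∖ S) full
  trapped S X closed v o Xv Xo Sv So conn =
    t≢f (trans (sym (reach-invariant (λ u → X u ≡ true) stay (conn v o (cong not Sv) (cong not So)) Xv)) Xo)
    where
    stay : ∀ e u w → act g (full ∖ S) full e ≡ true → Link g e u w → X u ≡ true → X w ≡ true
    stay e u w ac l Xu with closed u w Xu (e , l)
    ... | inj₁ Xw = Xw
    ... | inj₂ Sw = ⊥-elim (t≢f (trans (sym Sw) (not-injective {S w} {false} (proj₂ (act-ends {full ∖ S} {full} ac l)))))

  no-loop : LoopFree g → ∀ {e v} → ¬ Link g e v v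
  no-loop lf {e} (inj₁ p) = lf e (trans (cong proj₁ p) (sym (cong proj₂ p)))
  no-loop lf {e} (inj₂ p) = lf e (trans (cong proj₁ p) (sym (cong proj₂ p)))

  edges-differ : ∀ {e e' a b c d} → Link g e a b → Link g e' c d →
                 ¬ (a ≡ c × b ≡ d) → ¬ (a ≡ d × b ≡ c) → e ≢ e'
  edges-differ l l' same swapped refl with link-unique l l'
  ... | inj₁ eq = same eq
  ... | inj₂ eq = swapped eq

  Incident : Sub (n g) → Sub (m g) → V → Sub (m g)
  Incident A F v e = act g A F e ∧ inc g v e

  triangle-edge : LoopFree g → (H : Sub (m g)) → ¬ Parallel g H → (A : Sub (n g)) →
                  ∀ v u w → count (Incident A H v) ≡ 2 →
                  (∀ o → A o ≡ true → o ≡ v ⊎ o ≡ u ⊎ o ≡ w) →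
                  ∃[ e ] act g A H e ≡ true × Link g e v u
  triangle-edge lf H simple A v u w deg₂ cover with pick (Incident A H v) deg₂
  ... | e₁ , i₁ , rest with count-member (Incident A H v ─ e₁) rest
  ...   | e₂ , i₂' = choose (toward e₁ i₁) (toward e₂ i₂)
    where
    i₂ = proj₁ (del-elim (Incident A H v) e₁ i₂')
    e₁≢e₂ : e₁ ≢ e₂
    e₁≢e₂ p = proj₂ (del-elim (Incident A H v) e₁ i₂') (sym p)
    toward : ∀ e → Incident A H v e ≡ true → Link g e v u ⊎ Link g e v w
    toward e i with inc-link {v} {e} (∧-elimʳ {act g A H e} i)
    ... | o , l with cover o (proj₂ (act-ends {A} {H} (∧-elimˡ i) l))
    ...   | inj₁ refl        = ⊥-elim (no-loop lf l)
    ...   | inj₂ (inj₁ refl) = inj₁ l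
    ...   | inj₂ (inj₂ refl) = inj₂ l
    choose : Link g e₁ v u ⊎ Link g e₁ v w → Link g e₂ v u ⊎ Link g e₂ v w →
             ∃[ e ] act g A H e ≡ true × Link g e v u
    choose (inj₁ l) _        = e₁ , ∧-elimˡ i₁ , l
    choose (inj₂ _) (inj₁ l) = e₂ , ∧-elimˡ i₂ , l
    choose (inj₂ l₁) (inj₂ l₂) =
      ⊥-elim (simple (e₁ , e₂ , e₁≢e₂ , ∧-elimˡ (∧-elimˡ i₁) , ∧-elimˡ (∧-elimˡ i₂) , link-same-ends l₁ l₂))

record ZeroTriangle (g : Gr) (H : Sub (m g)) (A : Sub (n g)) : Set where
  field
    x y z   : Fin (n g)
    x≢y     : x ≢ y
    x≢z     : x ≢ z
    y≢z     : y ≢ z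
    A-cover : ∀ v → A v ≡ true → v ≡ x ⊎ v ≡ y ⊎ v ≡ z
    A-x     : A x ≡ true
    A-y     : A y ≡ true
    A-z     : A z ≡ true
    e₀      : Fin (m g)
    e₀-link : Link g e₀ x y
    e₀-zero : unit g e₀ ≡ false
    spoke   : ∀ {w} → w ≡ x ⊎ w ≡ y →
              ∃[ e ] Link g e z w × act g A H e ≡ true × unit g e ≡ true

⊎-swap₂₃ : ∀ {P Q R : Set} → P ⊎ Q ⊎ R → P ⊎ R ⊎ Q
⊎-swap₂₃ (inj₁ p)        = inj₁ p
⊎-swap₂₃ (inj₂ (inj₁ q)) = inj₂ (inj₂ q)
⊎-swap₂₃ (inj₂ (inj₂ r)) = inj₂ (inj₁ r)

⊎-rotate : ∀ {P Q R : Set} → P ⊎ Q ⊎ R → Q ⊎ R ⊎ P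
⊎-rotate (inj₁ p)        = inj₂ (inj₂ p)
⊎-rotate (inj₂ (inj₁ q)) = inj₁ q
⊎-rotate (inj₂ (inj₂ r)) = inj₂ (inj₁ r)

-- Labelling a small triangle block: since A carries at most two unit-edges,
-- one of its three edges is a zero-edge xy, and as zero-edges form a matching
-- the other two edges are unit-edges.
module Labelling (g : Gr) (lf : LoopFree g) (zero-matching : ZeroMatching g)
                 (H : Sub (m g)) (simple : ¬ Parallel g H) (A : Sub (n g)) where
  open Walks g

  beside-zero : ∀ {e₀ e v} → e₀ ≢ e → unit g e₀ ≡ false →
                inc g v e₀ ≡ true → inc g v e ≡ true → unit g e ≡ true
  beside-zero {e₀} {e} {v} e₀≢e u₀ i₀ i with unit g e in u
  ... | true  = refl
  ... | false = ⊥-elim (t≢f (trans (sym i) (zero-matching e₀ e e₀≢e u₀ u v i₀)))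

  labelled : ∀ x y z → x ≢ y → x ≢ z → y ≢ z →
             (∀ v → A v ≡ true → v ≡ x ⊎ v ≡ y ⊎ v ≡ z) →
             A x ≡ true → A y ≡ true → A z ≡ true →
             ∀ e₀ → Link g e₀ x y → unit g e₀ ≡ false →
             ∀ ex → Link g ex z x → act g A H ex ≡ true →
             ∀ ey → Link g ey z y → act g A H ey ≡ true → ZeroTriangle g H A
  labelled x y z x≢y x≢z y≢z cover Ax Ay Az e₀ l₀ u₀ ex lx ax ey ly ay = record
    { x = x ; y = y ; z = z ; x≢y = x≢y ; x≢z = x≢z ; y≢z = y≢z
    ; A-cover = cover ; A-x = Ax ; A-y = Ay ; A-z = Az
    ; e₀ = e₀ ; e₀-link = l₀ ; e₀-zero = u₀ ; spoke = spokes }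
    where
    spokes : ∀ {w} → w ≡ x ⊎ w ≡ y → ∃[ e ] Link g e z w × act g A H e ≡ true × unit g e ≡ true
    spokes (inj₁ refl) = ex , lx , ax ,
      beside-zero (edges-differ l₀ lx (λ p → x≢z (proj₁ p)) (λ p → y≢z (proj₂ p)))
                  u₀ (link-inc l₀) (link-inc (link-sym lx))
    spokes (inj₂ refl) = ey , ly , ay ,
      beside-zero (edges-differ l₀ ly (λ p → x≢z (proj₁ p)) (λ p → x≢y (proj₁ p)))
                  u₀ (link-inc (link-sym l₀)) (link-inc (link-sym ly))

  zero-triangle : Small g H A → IsTriangle g H A → ZeroTriangle g H A
  zero-triangle small (three , _ , deg₂) with count-three A three
  ... | p , q , r , Ap , Aq , Ar , p≢q , p≢r , q≢r , cover
    with triangle-edge lf H simple A p q r (deg₂ p Ap) cover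
       | triangle-edge lf H simple A p r q (deg₂ p Ap) (λ o Ao → ⊎-swap₂₃ (cover o Ao))
       | triangle-edge lf H simple A q r p (deg₂ q Aq) (λ o Ao → ⊎-rotate (cover o Ao))
  ... | epq , apq , lpq | epr , apr , lpr | eqr , aqr , lqr
    with unit g epq in upq | unit g epr in upr | unit g eqr in uqr
  ... | false | _ | _ =
    labelled p q r p≢q p≢r q≢r cover Ap Aq Ar
             epq lpq upq epr (link-sym lpr) apr eqr (link-sym lqr) aqr
  ... | true | false | _ =
    labelled p r q p≢r p≢q (λ e → q≢r (sym e)) (λ o Ao → ⊎-swap₂₃ (cover o Ao)) Ap Ar Aq
             epr lpr upr epq (link-sym lpq) apq eqr lqr aqr
  ... | true | true | false =
    labelled q r p q≢r (λ e → p≢q (sym e)) (λ e → p≢r (sym e)) (λ o Ao → ⊎-rotate (cover o Ao)) Aq Ar Ap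
             eqr lqr uqr epq lpq apq epr lpr apr
  ... | true | true | true = ⊥-elim (three-units (≤-trans three-≤-units small))
    where
    three-units : ¬ (3 ≤ 2)
    three-units (s≤s (s≤s ()))
    unit-in-A : ∀ {e} → act g A H e ≡ true → unit g e ≡ true → (act g A H e ∧ unit g e) ≡ true
    unit-in-A a u rewrite a | u = refl
    three-≤-units : 3 ≤ count (λ e → act g A H e ∧ unit g e)
    three-≤-units = three-≤ _ epq epr eqr (unit-in-A apq upq) (unit-in-A apr upr) (unit-in-A aqr uqr)
      (edges-differ lpq lpr (λ e → q≢r (proj₂ e)) (λ e → p≢r (proj₁ e)))
      (edges-differ lpq lqr (λ e → p≢q (proj₁ e)) (λ e → p≢r (proj₁ e)))
      (edges-differ lpr lqr (λ e → p≢q (proj₁ e)) (λ e → p≢r (proj₁ e)))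

-- Choosing the good swappable edge of a labelled triangle block A.
module SwapChoice (g : Gr) (no-cut : ∀ w → ¬ CutNode g w) (no-zero-S2 : ∀ e → ¬ ZeroS2 g e)
                  (H : Sub (m g)) (A : Sub (n g)) (A-block : Block g H A)
                  (T : ZeroTriangle g H A) where
  open Walks g
  open ZeroTriangle T

  XY : V → Set
  XY w = w ≡ x ⊎ w ≡ y

  Touches : V → Sub (n g) → Set
  Touches v B = Block g H B × Distinct B A × AdjTo g v B

  outside≢ : ∀ {v o} → A v ≡ true → A o ≡ false → o ≢ v
  outside≢ Av Ao refl = t≢f (trans (sym Av) Ao)

  touches-attach : ∀ {v B} → A v ≡ true → Touches v B → Attach g A v
  touches-attach Av (B-block , B≢A , b , Bb , adj) =
    Av , b , component-disjoint B-block A-block B≢A b Bb , adj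

  attach-touches : ∀ {v} → Attach g A v → ∃[ B ] Touches v B
  attach-touches (_ , o , Ao , adj) with component-of H o
  ... | B , B-block , Bo = B , B-block , distinct-at o Bo Ao , o , Bo , adj

  good-edge : ∀ {e Bu Bv} → act g A H e ≡ true → unit g e ≡ true →
              Touches (proj₁ (ends g e)) Bu → Touches (proj₂ (ends g e)) Bv →
              Distinct Bu Bv → Good g H A e
  good-edge {e} ac un tu@(bu , du , au) tv@(bv , dv , av) duv =
    (ac , un , touches-attach (∧-elimˡ A-ends) tu , touches-attach (∧-elimʳ A-ends) tv) ,
    _ , _ , bu , bv , duv , du , dv , au , av
    where
    A-ends = ∧-elimʳ {H e} ac

  good-spoke : ∀ {w Bz Bw} → XY w → Touches z Bz → Touches w Bw → Distinct Bz Bw →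
               ∃[ e ] Good g H A e
  good-spoke {Bz = Bz} {Bw} xy tz tw d with spoke xy
  ... | e , inj₁ p , ac , un =
    e , good-edge ac un (subst (λ v → Touches v Bz) (sym (cong proj₁ p)) tz)
                        (subst (λ v → Touches v Bw) (sym (cong proj₂ p)) tw) d
  ... | e , inj₂ p , ac , un =
    e , good-edge ac un (subst (λ v → Touches v Bw) (sym (cong proj₁ p)) tw)
                        (subst (λ v → Touches v Bz) (sym (cong proj₂ p)) tz) (distinct-sym d)

  inner : ∀ {v w} → ¬ Attach g A v → A v ≡ true → Adj g v w → A w ≡ true
  inner {v} {w} ¬att Av adj with A w in Aw
  ... | true  = refl
  ... | false = ⊥-elim (¬att (Av , w , Aw , adj))

  -- z has a neighbour outside A: otherwise all neighbours of z are x or y,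
  -- so G - {x , y} is disconnected and xy would be a zero-cost S2
  z-attached : ∀ o → A o ≡ false → Attach g A z
  z-attached o Ao with attach? A z
  ... | yes att = att
  ... | no ¬att = ⊥-elim (no-zero-S2 e₀ (e₀-zero ,
        trapped S (λ v → ⌊ v ≟ z ⌋) closed z o (⌊⌋-true (z ≟ z) refl)
                (⌊⌋-false (o ≟ z) (outside≢ A-z Ao))
                (S-out (λ p → x≢z (sym p)) (λ p → y≢z (sym p)))
                (S-out (outside≢ A-x Ao) (outside≢ A-y Ao))))
    where
    S : Sub (n g)
    S = pair (proj₁ (ends g e₀)) (proj₂ (ends g e₀))
    S-out : ∀ {v} → v ≢ x → v ≢ y → S v ≡ false
    S-out {v} v≢x v≢y = trans (ends-pair e₀-link v) (pair-out v≢x v≢y)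
    closed : ∀ v w → ⌊ v ≟ z ⌋ ≡ true → Adj g v w → ⌊ w ≟ z ⌋ ≡ true ⊎ S w ≡ true
    closed v w h adj with ⌊⌋-elim (v ≟ z) h
    ... | refl with A-cover w (inner ¬att A-z adj)
    ...   | inj₁ refl        = inj₂ (trans (ends-pair e₀-link x) (pair-introˡ x y))
    ...   | inj₂ (inj₁ refl) = inj₂ (trans (ends-pair e₀-link y) (pair-introʳ x y))
    ...   | inj₂ (inj₂ refl) = inj₁ (⌊⌋-true (z ≟ z) refl)

  -- x or y has a neighbour outside A: otherwise all neighbours of x and y
  -- lie in {x , y , z}, and z would be a cut node
  xy-attached : ∀ o → A o ≡ false → ∃[ w ] XY w × Attach g A w
  xy-attached o Ao with attach? A x | attach? A y
  ... | yes att | _       = x , inj₁ refl , att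
  ... | no _    | yes att = y , inj₂ refl , att
  ... | no ¬x   | no ¬y   = ⊥-elim (no-cut z
        (trapped (λ v → ⌊ v ≟ z ⌋) (pair x y) closed x o (pair-introˡ x y)
                 (pair-out (outside≢ A-x Ao) (outside≢ A-y Ao))
                 (⌊⌋-false (x ≟ z) x≢z) (⌊⌋-false (o ≟ z) (outside≢ A-z Ao))))
    where
    inside : ∀ {v w} → XY v → Adj g v w → A w ≡ true
    inside (inj₁ refl) adj = inner ¬x A-x adj
    inside (inj₂ refl) adj = inner ¬y A-y adj
    closed : ∀ v w → pair x y v ≡ true → Adj g v w → pair x y w ≡ true ⊎ ⌊ w ≟ z ⌋ ≡ true
    closed v w h adj with A-cover w (inside (pair-elim h) adj)
    ... | inj₁ refl        = inj₁ (pair-introˡ x y)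
    ... | inj₂ (inj₁ refl) = inj₁ (pair-introʳ x y)
    ... | inj₂ (inj₂ refl) = inj₂ (⌊⌋-true (z ≟ z) refl)

  EndTouch : Sub (n g) → Set
  EndTouch B = Touches z B ⊎ ∃[ w ] XY w × Touches w B

  end-touch : ∀ {B} → Block g H B → Distinct B A → AdjSet g A B → EndTouch B
  end-touch B-block B≢A (a , b , Aa , Bb , adj) with A-cover a Aa
  ... | inj₁ refl        = inj₂ (x , inj₁ refl , B-block , B≢A , b , Bb , adj)
  ... | inj₂ (inj₁ refl) = inj₂ (y , inj₂ refl , B-block , B≢A , b , Bb , adj)
  ... | inj₂ (inj₂ refl) = inj₁ (B-block , B≢A , b , Bb , adj)

  -- If z touches Cz, some w ∈ {x , y} touches Cw, and B ≠ Cz is touched by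
  -- x, y or z, then some spoke is good: either B is touched by x or y, or
  -- Cw differs from one of the two distinct blocks B, Cz touched by z.
  good-from : ∀ {Cz Cw w B} → Touches z Cz → XY w → Touches w Cw → EndTouch B →
              Distinct Cz B → ∃[ e ] Good g H A e
  good-from tz xy tw (inj₂ (_ , xy' , tw')) Cz≢B = good-spoke xy' tz tw' Cz≢B
  good-from tz xy tw (inj₁ tzB) Cz≢B
    with distinct-from-one (proj₁ tw) (proj₁ tzB) (proj₁ tz) (distinct-sym Cz≢B)
  ... | inj₁ Cw≢B  = good-spoke xy tzB tw (distinct-sym Cw≢B)
  ... | inj₂ Cw≢Cz = good-spoke xy tz tw (distinct-sym Cw≢Cz)

  good-swappable : ∀ B₁ B₂ → Block g H B₁ → Block g H B₂ →
                   Distinct B₁ A → Distinct B₂ A → Distinct B₁ B₂ →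
                   AdjSet g A B₁ → AdjSet g A B₂ → ∃[ e ] Good g H A e
  good-swappable B₁ B₂ b₁ b₂ B₁≢A B₂≢A B₁≢B₂ adj₁@(_ , o , _ , B₁o , _) adj₂ =
    combine (attach-touches (z-attached o Ao)) (xy-attached o Ao)
    where
    Ao : A o ≡ false
    Ao = component-disjoint b₁ A-block B₁≢A o B₁o
    combine : ∃[ C ] Touches z C → ∃[ w ] XY w × Attach g A w → ∃[ e ] Good g H A e
    combine (Cz , tz) (w , xy , w-att) with attach-touches w-att | distinct-from-one (proj₁ tz) b₁ b₂ B₁≢B₂
    ... | _ , tw | inj₁ Cz≢B₁ = good-from tz xy tw (end-touch b₁ B₁≢A adj₁) Cz≢B₁
    ... | _ , tw | inj₂ Cz≢B₂ = good-from tz xy tw (end-touch b₂ B₂≢A adj₂) Cz≢B₂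

lemma34 : (G : Gr) → WellStructured G →
          (H : Sub (m G)) → GoodH G H →
          (A : Sub (n G)) → Block G H A → Small G H A → IsTriangle G H A →
          (∃[ B₁ ] ∃[ B₂ ] Block G H B₁ × Block G H B₂ ×
             Distinct B₁ A × Distinct B₂ A × Distinct B₁ B₂ ×
             AdjSet G A B₁ × AdjSet G A B₂) →
          ∃[ e ] Good G H A e
lemma34 G ((loop-free , _ , zero-matching) , _ , no-cut , _ , no-zero-S2 , _)
        H (_ , simple , _) A A-block small triangle
        (B₁ , B₂ , b₁ , b₂ , B₁≢A , B₂≢A , B₁≢B₂ , adj₁ , adj₂) =
  SwapChoice.good-swappable G no-cut no-zero-S2 H A A-block labelled
    B₁ B₂ b₁ b₂ B₁≢A B₂≢A B₁≢B₂ adj₁ adj₂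
  where
  labelled : ZeroTriangle G H A
  labelled = Labelling.zero-triangle G loop-free zero-matching H simple A small triangle
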